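{- $\chi(\mathbb{Z}^{3},\sqrt{2})=4$.
   Context: For a metric space $M$ and a real number $d>0$, the chromatic number $\chi(M,d)$ is the minimal cardinality of a set $S$ for which there is a map $f:M\to S$ with $f(x)\neq f(y)$ whenever the distance between $x$ and $y$ equals $d$. Here $\mathbb{Z}^{3}$ carries the Euclidean metric. -}

module Defs where

open import Data.Integer using (ℤ; _+_; _*_; _-_; +_)
open import Data.Product using (_×_; _,_; Σ; ∃)
open import Data.Fin using (Fin)
open import Data.Nat using (ℕ)
open import Function.Definitions using (Injective)
open import Relation.Binary.PropositionalEquality using (_≡_; _≢_)

ℤ³ : Set
ℤ³ = ℤ × ℤ × ℤ

dist² : ℤ³ → ℤ³ → ℤ
dist² (a₁ , a₂ , a₃) (b₁ , b₂ , b₃) =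
  (a₁ - b₁) * (a₁ - b₁) + (a₂ - b₂) * (a₂ - b₂) + (a₃ - b₃) * (a₃ - b₃)

ProperSqrt2 : ∀ {ℓ} {S : Set ℓ} → (ℤ³ → S) → Set ℓ
ProperSqrt2 f = ∀ x y → dist² x y ≡ + 2 → f x ≢ f y

-- χ(ℤ³, √2) = n : there is a proper colouring with a set of n colours,
-- and every set S admitting a proper colouring has cardinality ≥ n
-- (witnessed by an injection Fin n → S).
ChromaticNumberSqrt2Is : ℕ → Set₁
ChromaticNumberSqrt2Is n =
  (Σ (ℤ³ → Fin n) ProperSqrt2) ×
  (∀ (S : Set) (f : ℤ³ → S) → ProperSqrt2 f →
     Σ (Fin n → S) λ g → Injective _≡_ _≡_ g)

module Submission where

-- Upper bound: colour a point by the parities of its first two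
-- coordinates (four colours).  If x and y receive the same colour, the
-- first two coordinate differences are even, so their squares vanish
-- modulo 4, while the square of the third difference is 0 or 1 modulo 4.
-- Hence dist² x y ≡ 0 or 1 (mod 4) and never equals 2.
--
-- Lower bound: the four even-weight vertices of the unit cube are at
-- mutual distance √2, and any proper colouring is injective on a set of
-- points at mutual distance √2.

open import Defs
open import Data.Integer using (ℤ; +_; ∣_∣; _+_; _-_; _*_)
open import Data.Integer.DivMod using (_%ℕ_; _/ℕ_; a≡a%ℕn+[a/ℕn]*n; n%ℕd<d)
open import Data.Integer.Divisibility.Signed using (divides; ∣⇒∣ᵤ)
open import Data.Integer.Tactic.RingSolver using (solve-∀)
open import Data.Nat as ℕ using (ℕ; z≤n; s≤s)
open import Data.Nat.Divisibility using (_∣_; >⇒∤)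
open import Data.Fin using (Fin; zero; suc; fromℕ<; combine; _≟_)
open import Data.Fin.Properties using (fromℕ<-injective; combine-injective)
open import Data.Product using (_×_; _,_; Σ; ∃-syntax; proj₁; proj₂)
open import Function using (_∘_)
open import Function.Definitions using (Injective)
open import Relation.Nullary using (yes; no; contradiction)
open import Relation.Binary.PropositionalEquality
  using (_≡_; _≢_; refl; sym; cong; cong₂; module ≡-Reasoning)
open ≡-Reasoning

sub-left : ∀ (r t : ℤ) → t ≡ (r + t) - r
sub-left = solve-∀

difference-of-same-remainder : ∀ (r x y k : ℤ) → (r + x * k) - (r + y * k) ≡ (x - y) * k
difference-of-same-remainder = solve-∀

square-expansion : ∀ (r q : ℤ) → (r + q * + 2) * (r + q * + 2) ≡ r * r + (r * q + q * q) * + 4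
square-expansion = solve-∀

sum-of-squares-expansion : ∀ (r t p q : ℤ) →
  (p * + 2) * (p * + 2) + (q * + 2) * (q * + 2) + (r + t * + 4) ≡ r + (p * p + q * q + t) * + 4
sum-of-squares-expansion = solve-∀

multiple⇒∣ : ∀ {k} {z : ℤ} (t : ℤ) → z ≡ t * + k → k ∣ ∣ z ∣
multiple⇒∣ t eq = ∣⇒∣ᵤ (divides t eq)

four-divides : ∀ {r} (t : ℤ) → + r + t * + 4 ≡ + 2 → 4 ∣ ∣ + 2 - + r ∣
four-divides {r} t eq = multiple⇒∣ t (sym (begin
  t * + 4               ≡⟨ sub-left (+ r) (t * + 4) ⟩
  (+ r + t * + 4) - + r ≡⟨ cong (_- + r) eq ⟩
  + 2 - + r             ∎))

same-remainder⇒multiple : ∀ (d : ℕ) .{{_ : ℕ.NonZero d}} (a b : ℤ) →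
  a %ℕ d ≡ b %ℕ d → a - b ≡ (a /ℕ d - b /ℕ d) * + d
same-remainder⇒multiple d a b same = begin
  a - b
    ≡⟨ cong₂ _-_ (a≡a%ℕn+[a/ℕn]*n a d) (a≡a%ℕn+[a/ℕn]*n b d) ⟩
  (+ (a %ℕ d) + a /ℕ d * + d) - (+ (b %ℕ d) + b /ℕ d * + d)
    ≡⟨ cong (λ r → (+ (a %ℕ d) + a /ℕ d * + d) - (+ r + b /ℕ d * + d)) (sym same) ⟩
  (+ (a %ℕ d) + a /ℕ d * + d) - (+ (a %ℕ d) + b /ℕ d * + d)
    ≡⟨ difference-of-same-remainder (+ (a %ℕ d)) (a /ℕ d) (b /ℕ d) (+ d) ⟩
  (a /ℕ d - b /ℕ d) * + d
    ∎

bit-square : ∀ {r} → r ℕ.< 2 → + r * + r ≡ + r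
bit-square (s≤s z≤n)       = refl
bit-square (s≤s (s≤s z≤n)) = refl

square-mod-4 : ∀ (c : ℤ) → Σ ℕ λ r → r ℕ.< 2 × ∃[ t ] c * c ≡ + r + t * + 4
square-mod-4 c = r , n%ℕd<d c 2 , + r * q + q * q , (begin
  c * c                                ≡⟨ cong₂ _*_ c≡r+2q c≡r+2q ⟩
  (+ r + q * + 2) * (+ r + q * + 2)    ≡⟨ square-expansion (+ r) q ⟩
  + r * + r + (+ r * q + q * q) * + 4  ≡⟨ cong (_+ (+ r * q + q * q) * + 4) (bit-square (n%ℕd<d c 2)) ⟩
  + r + (+ r * q + q * q) * + 4        ∎)
  where
  r : ℕ
  r = c %ℕ 2
  q : ℤ
  q = c /ℕ 2
  c≡r+2q : c ≡ + r + q * + 2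
  c≡r+2q = a≡a%ℕn+[a/ℕn]*n c 2

-- A number of the form r + 4t with r ∈ {0, 1} is never 2,
-- since 4 divides neither 2 nor 1.
not-two-mod-4 : ∀ {r} (t : ℤ) → r ℕ.< 2 → + r + t * + 4 ≢ + 2
not-two-mod-4 t (s≤s z≤n)       eq = >⇒∤ (s≤s (s≤s (s≤s z≤n))) (four-divides t eq)
not-two-mod-4 t (s≤s (s≤s z≤n)) eq = >⇒∤ (s≤s (s≤s z≤n)) (four-divides t eq)

-- Squared distance 2 never occurs when the first two coordinate
-- differences are even: the sum is then 0 or 1 modulo 4.
even-even-not-two : ∀ (p q c : ℤ) → (p * + 2) * (p * + 2) + (q * + 2) * (q * + 2) + c * c ≢ + 2
even-even-not-two p q c eq with square-mod-4 c
... | r , r<2 , t , c²≡r+4t = not-two-mod-4 (p * p + q * q + t) r<2 (begin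
  + r + (p * p + q * q + t) * + 4
    ≡⟨ sum-of-squares-expansion (+ r) t p q ⟨
  (p * + 2) * (p * + 2) + (q * + 2) * (q * + 2) + (+ r + t * + 4)
    ≡⟨ cong (λ s → (p * + 2) * (p * + 2) + (q * + 2) * (q * + 2) + s) c²≡r+4t ⟨
  (p * + 2) * (p * + 2) + (q * + 2) * (q * + 2) + c * c
    ≡⟨ eq ⟩
  + 2 ∎)

parity : ℤ → Fin 2
parity a = fromℕ< (n%ℕd<d a 2)

parityColour : ℤ³ → Fin 4
parityColour (a₁ , a₂ , _) = combine (parity a₁) (parity a₂)

parityColour-proper : ProperSqrt2 parityColour
parityColour-proper (a₁ , a₂ , a₃) (b₁ , b₂ , b₃) eq same-colour =
  even-even-not-two (a₁ /ℕ 2 - b₁ /ℕ 2) (a₂ /ℕ 2 - b₂ /ℕ 2) (a₃ - b₃) (begin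
    (a₁ /ℕ 2 - b₁ /ℕ 2) * + 2 * ((a₁ /ℕ 2 - b₁ /ℕ 2) * + 2)
      + (a₂ /ℕ 2 - b₂ /ℕ 2) * + 2 * ((a₂ /ℕ 2 - b₂ /ℕ 2) * + 2)
      + (a₃ - b₃) * (a₃ - b₃)
      ≡⟨ cong₂ (λ d₁ d₂ → d₁ * d₁ + d₂ * d₂ + (a₃ - b₃) * (a₃ - b₃)) d₁-even d₂-even ⟨
    dist² (a₁ , a₂ , a₃) (b₁ , b₂ , b₃)
      ≡⟨ eq ⟩
    + 2 ∎)
  where
  same-parities : parity a₁ ≡ parity b₁ × parity a₂ ≡ parity b₂
  same-parities = combine-injective (parity a₁) (parity a₂) (parity b₁) (parity b₂) same-colour
  d₁-even : a₁ - b₁ ≡ (a₁ /ℕ 2 - b₁ /ℕ 2) * + 2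
  d₁-even = same-remainder⇒multiple 2 a₁ b₁ (fromℕ<-injective _ _ (n%ℕd<d a₁ 2) (n%ℕd<d b₁ 2) (proj₁ same-parities))
  d₂-even : a₂ - b₂ ≡ (a₂ /ℕ 2 - b₂ /ℕ 2) * + 2
  d₂-even = same-remainder⇒multiple 2 a₂ b₂ (fromℕ<-injective _ _ (n%ℕd<d a₂ 2) (n%ℕd<d b₂ 2) (proj₂ same-parities))

clique-injective : ∀ {ℓ} {S : Set ℓ} {n} (f : ℤ³ → S) → ProperSqrt2 f →
  (p : Fin n → ℤ³) → (∀ i j → i ≢ j → dist² (p i) (p j) ≡ + 2) →
  Injective _≡_ _≡_ (f ∘ p)
clique-injective f proper p clique {i} {j} same-colour with i ≟ j
... | yes i≡j = i≡j
... | no  i≢j = contradiction same-colour (proper (p i) (p j) (clique i j i≢j))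

-- The even-weight vertices of the unit cube: a regular tetrahedron of
-- edge √2.
tetrahedron : Fin 4 → ℤ³
tetrahedron zero                   = (+ 0 , + 0 , + 0)
tetrahedron (suc zero)             = (+ 1 , + 1 , + 0)
tetrahedron (suc (suc zero))       = (+ 1 , + 0 , + 1)
tetrahedron (suc (suc (suc zero))) = (+ 0 , + 1 , + 1)

tetrahedron-clique : ∀ i j → i ≢ j → dist² (tetrahedron i) (tetrahedron j) ≡ + 2
tetrahedron-clique zero                   zero                   i≢i = contradiction refl i≢i
tetrahedron-clique zero                   (suc zero)             _   = refl
tetrahedron-clique zero                   (suc (suc zero))       _   = refl
tetrahedron-clique zero                   (suc (suc (suc zero))) _   = refl
tetrahedron-clique (suc zero)             zero                   _   = refl
tetrahedron-clique (suc zero)             (suc zero)             i≢i = contradiction refl i≢i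
tetrahedron-clique (suc zero)             (suc (suc zero))       _   = refl
tetrahedron-clique (suc zero)             (suc (suc (suc zero))) _   = refl
tetrahedron-clique (suc (suc zero))       zero                   _   = refl
tetrahedron-clique (suc (suc zero))       (suc zero)             _   = refl
tetrahedron-clique (suc (suc zero))       (suc (suc zero))       i≢i = contradiction refl i≢i
tetrahedron-clique (suc (suc zero))       (suc (suc (suc zero))) _   = refl
tetrahedron-clique (suc (suc (suc zero))) zero                   _   = refl
tetrahedron-clique (suc (suc (suc zero))) (suc zero)             _   = refl
tetrahedron-clique (suc (suc (suc zero))) (suc (suc zero))       _   = refl
tetrahedron-clique (suc (suc (suc zero))) (suc (suc (suc zero))) i≢i = contradiction refl i≢i

mainTheorem3 : ChromaticNumberSqrt2Is 4
mainTheorem3 =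
  (parityColour , parityColour-proper) ,
  λ S f proper → f ∘ tetrahedron , clique-injective f proper tetrahedron tetrahedron-clique
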